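{- Let $n\ge 3$, let $\vec a=(a_1,\dots,a_n)$ be a vector of positive integers, and let $\vec b=(a_{\sigma(1)},\dots,a_{\sigma(n)})$ for some permutation $\sigma$ of $\{1,\dots,n\}$. Then the sandpile groups of the thick cycles $C_{\vec a}$ and $C_{\vec b}$ are isomorphic: $\mathcal S(C_{\vec a})\cong\mathcal S(C_{\vec b})$.
   Context: A thick $n$-cycle $C_{\vec a}$ with multiplicity vector $\vec a=(a_1,\dots,a_n)$ (positive integers) is the undirected multigraph on vertices $v_1,\dots,v_n$ in which $v_i$ and $v_{i+1}$ are joined by exactly $a_i$ parallel edges (indices modulo $n$), and there are no other edges. The Laplacian $L$ of an undirected multigraph on vertices $v_1,\dots,v_n$ has $L_{ii}=\deg(v_i)$ and $L_{ij}=-(\text{number of edges joining } v_i,v_j)$ for $i\ne j$. For a connected graph, the sandpile group $\mathcal S(G)$ is $\mathbb Z^{n-1}/\tilde\Delta\,\mathbb Z^{n-1}$, where $\tilde\Delta$ is the matrix obtained from $L$ by deleting the row and column of some vertex (the result is independent of the choice up to isomorphism). -}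

module Defs where

open import Data.Nat as ℕ using (ℕ; zero; suc; _%_; pred)
open import Data.Nat.DivMod using (m%n<n)
open import Data.Integer as ℤ using (ℤ; +_; -_; _-_)
open import Data.Fin as Fin using (Fin; toℕ; fromℕ<; inject₁)
open import Data.Product using (∃; _×_)
open import Data.Sum using (_⊎_)
open import Relation.Nullary.Decidable using (⌊_⌋; _×-dec_; _⊎-dec_)
open import Relation.Binary.PropositionalEquality using (_≡_)

Σℕ : ∀ {n} → (Fin n → ℕ) → ℕ
Σℕ {zero}  f = 0
Σℕ {suc n} f = f Fin.zero ℕ.+ Σℕ (λ i → f (Fin.suc i))

Σℤ : ∀ {n} → (Fin n → ℤ) → ℤ
Σℤ {zero}  f = + 0
Σℤ {suc n} f = f Fin.zero ℤ.+ Σℤ (λ i → f (Fin.suc i))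

next : ∀ {n} → Fin n → Fin n
next {suc m} i = fromℕ< (m%n<n (suc (toℕ i)) (suc m))

-- Number of edges joining v_i and v_j in the thick cycle C_a:
-- for each k, the a_k parallel edges join v_k and v_{k+1}.
thickEdges : ∀ {n} → (Fin n → ℕ) → Fin n → Fin n → ℕ
thickEdges a i j =
  Σℕ (λ k → if ⌊ ((k Fin.≟ i) ×-dec (next k Fin.≟ j)) ⊎-dec ((k Fin.≟ j) ×-dec (next k Fin.≟ i)) ⌋
             then a k else 0)
  where open import Data.Bool using (if_then_else_)

Matrix : ℕ → ℕ → Set
Matrix m k = Fin m → Fin k → ℤ

degree : ∀ {n} → (Fin n → Fin n → ℕ) → Fin n → ℕ
degree {n} e i = Σℕ (λ j → if ⌊ i Fin.≟ j ⌋ then 0 else e i j)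
  where open import Data.Bool using (if_then_else_)

laplacian : ∀ {n} → (Fin n → Fin n → ℕ) → Matrix n n
laplacian e i j = if ⌊ i Fin.≟ j ⌋ then + degree e i else - (+ e i j)
  where open import Data.Bool using (if_then_else_)

reduced : ∀ {n} → Matrix n n → Matrix (pred n) (pred n)
reduced {zero}  L i j = L i j
reduced {suc m} L i j = L (inject₁ i) (inject₁ j)

Vecℤ : ℕ → Set
Vecℤ m = Fin m → ℤ

_·_ : ∀ {m k} → Matrix m k → Vecℤ k → Vecℤ m
(M · z) i = Σℤ (λ j → M i j ℤ.* z j)

_+ᵛ_ : ∀ {m} → Vecℤ m → Vecℤ m → Vecℤ m
(x +ᵛ y) i = x i ℤ.+ y i

_≈[_]_ : ∀ {m} → Vecℤ m → Matrix m m → Vecℤ m → Set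
x ≈[ M ] y = ∃ λ z → ∀ i → x i - y i ≡ (M · z) i

record CokerIso {m k : ℕ} (M : Matrix m m) (N : Matrix k k) : Set where
  field
    to       : Vecℤ m → Vecℤ k
    from     : Vecℤ k → Vecℤ m
    to-cong  : ∀ x y → x ≈[ M ] y → to x ≈[ N ] to y
    from-cong : ∀ x y → x ≈[ N ] y → from x ≈[ M ] from y
    to-hom   : ∀ x y → to (x +ᵛ y) ≈[ N ] (to x +ᵛ to y)
    from-hom : ∀ x y → from (x +ᵛ y) ≈[ M ] (from x +ᵛ from y)
    to-from  : ∀ y → to (from y) ≈[ N ] y
    from-to  : ∀ x → from (to x) ≈[ M ] x

-- Sandpile group of the thick cycle C_a, presented by its reduced Laplacian
sandpileMatrix : ∀ {n} → (Fin n → ℕ) → Matrix (pred n) (pred n)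
sandpileMatrix a = reduced (laplacian (thickEdges a))

SandpileIso : ∀ {n} → (Fin n → ℕ) → (Fin n → ℕ) → Set
SandpileIso a b = CokerIso (sandpileMatrix a) (sandpileMatrix b)

-- Ground the potential at the last vertex. The reduced Laplacian of C_a sends z to
-- the divergence ∂ of the edge currents k ↦ a_k (x_k − x_{k+1}), where x is z
-- extended by 0, and these potential drops range over exactly the zero-sum vectors
-- of ℤ^n; so its image is { ∂ (a ⊙ t) : Σ t = 0 }. As ∂ identifies ℤ^n modulo
-- constants with ℤ^{n−1}, relabelling the edges by σ is an automorphism of ℤ^{n−1}
-- carrying this image for a onto the one for a ∘ σ.
module Submission where

open import Defs
open import Data.Nat using (ℕ; _≤_; _<_)
open import Data.Fin using (Fin)
open import Data.Fin.Permutation using (Permutation′; _⟨$⟩ʳ_)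

open import Data.Nat using (zero; suc; s≤s; _%_)
open import Data.Nat.DivMod using (m<n⇒m%n≡m; n%n≡0)
open import Data.Integer using (ℤ; +_; -_; _-_; _+_; _*_)
import Data.Integer.Properties as ℤP
open import Data.Integer.Tactic.RingSolver using (solve-∀)
open import Data.Fin using (zero; suc; toℕ; inject₁; fromℕ; punchIn; _≟_)
import Data.Fin.Properties as FinP
open import Data.Fin.Relation.Unary.Top using (view; ‵fromℕ; ‵inject₁)
open import Data.Fin.Permutation using (permutation; _⟨$⟩ˡ_; inverseˡ; inverseʳ; flip)
open import Data.Bool using (if_then_else_)
open import Data.Empty using (⊥-elim)
open import Data.Product using (∃; _,_)
open import Function using (_∘_)
open import Relation.Nullary using (yes; no; does)
open import Relation.Nullary.Decidable using (⌊_⌋; _×-dec_; _⊎-dec_)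
open import Relation.Binary.PropositionalEquality
open import Algebra.Properties.Semiring.Sum ℤP.+-*-semiring
  using (sum; sum-cong-≗; ∑-distrib-+; *-distribʳ-sum; sum-init-last; sum-remove; sum-permute)
open import Algebra.Properties.AbelianGroup ℤP.+-0-abelianGroup using (∙-cancelʳ)

open ≡-Reasoning

Σℤ-sum : ∀ {n} (f : Fin n → ℤ) → Σℤ f ≡ sum f
Σℤ-sum {zero}  f = refl
Σℤ-sum {suc n} f = cong (_+_ (f zero)) (Σℤ-sum (f ∘ suc))

Σℤ-cong : ∀ {n} {f g : Fin n → ℤ} → f ≗ g → Σℤ f ≡ Σℤ g
Σℤ-cong {f = f} {g} f≗g rewrite Σℤ-sum f | Σℤ-sum g = sum-cong-≗ f≗g

Σℤ-zero : ∀ {n} → Σℤ {n} (λ _ → + 0) ≡ + 0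
Σℤ-zero {zero}  = refl
Σℤ-zero {suc n} = trans (ℤP.+-identityˡ _) (Σℤ-zero {n})

Σℤ-+ : ∀ {n} (f g : Fin n → ℤ) → Σℤ (λ i → f i + g i) ≡ Σℤ f + Σℤ g
Σℤ-+ f g rewrite Σℤ-sum (λ i → f i + g i) | Σℤ-sum f | Σℤ-sum g = ∑-distrib-+ f g

Σℤ-neg : ∀ {n} (f : Fin n → ℤ) → Σℤ (λ i → - f i) ≡ - Σℤ f
Σℤ-neg {zero}  f = refl
Σℤ-neg {suc n} f =
  trans (cong (_+_ (- f zero)) (Σℤ-neg (f ∘ suc))) (sym (ℤP.neg-distrib-+ (f zero) _))

Σℤ-- : ∀ {n} (f g : Fin n → ℤ) → Σℤ (λ i → f i - g i) ≡ Σℤ f - Σℤ g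
Σℤ-- f g = trans (Σℤ-+ f (-_ ∘ g)) (cong (_+_ (Σℤ f)) (Σℤ-neg g))

Σℤ-*ʳ : ∀ {n} (f : Fin n → ℤ) c → Σℤ f * c ≡ Σℤ (λ i → f i * c)
Σℤ-*ʳ f c rewrite Σℤ-sum f | Σℤ-sum (λ i → f i * c) = *-distribʳ-sum c f

Σℤ-init-last : ∀ {n} (f : Fin (suc n) → ℤ) → Σℤ f ≡ Σℤ (f ∘ inject₁) + f (fromℕ n)
Σℤ-init-last f rewrite Σℤ-sum f | Σℤ-sum (f ∘ inject₁) = sum-init-last f

Σℤ-remove : ∀ {n} p (f : Fin (suc n) → ℤ) → Σℤ f ≡ f p + Σℤ (f ∘ punchIn p)
Σℤ-remove p f rewrite Σℤ-sum f | Σℤ-sum (f ∘ punchIn p) = sum-remove {i = p} f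

Σℤ-permute : ∀ {n} (σ : Permutation′ n) (f : Fin n → ℤ) → Σℤ (f ∘ (σ ⟨$⟩ʳ_)) ≡ Σℤ f
Σℤ-permute σ f rewrite Σℤ-sum f | Σℤ-sum (f ∘ (σ ⟨$⟩ʳ_)) = sym (sum-permute f σ)

pos-Σℕ : ∀ {n} (f : Fin n → ℕ) → + Σℕ f ≡ Σℤ (+_ ∘ f)
pos-Σℕ {zero}  f = refl
pos-Σℕ {suc n} f = trans (ℤP.pos-+ (f zero) _) (cong (_+_ (+ f zero)) (pos-Σℕ (f ∘ suc)))

Σℤ-agree : ∀ {n} {f g : Fin (suc n) → ℤ} p →
  Σℤ f ≡ Σℤ g → (∀ k → k ≢ p → f k ≡ g k) → f p ≡ g p
Σℤ-agree {f = f} {g} p Σf≡Σg f≡g = ∙-cancelʳ (Σℤ (f ∘ punchIn p)) (f p) (g p) (begin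
  f p + Σℤ (f ∘ punchIn p)  ≡⟨ Σℤ-remove p f ⟨
  Σℤ f                      ≡⟨ Σf≡Σg ⟩
  Σℤ g                      ≡⟨ Σℤ-remove p g ⟩
  g p + Σℤ (g ∘ punchIn p)  ≡⟨ cong (_+_ (g p)) (Σℤ-cong (λ j → f≡g _ (FinP.punchInᵢ≢i p j))) ⟨
  g p + Σℤ (f ∘ punchIn p)  ∎)

_-ᵛ_ : ∀ {m} → Vecℤ m → Vecℤ m → Vecℤ m
(x -ᵛ y) i = x i - y i

record IsAdditive {m k} (f : Vecℤ m → Vecℤ k) : Set where
  field
    cong-≗ : ∀ {x y} → x ≗ y → f x ≗ f y
    +-homo : ∀ x y → f (x +ᵛ y) ≗ f x +ᵛ f y

  -ᵛ-homo : ∀ x y → f (x -ᵛ y) ≗ f x -ᵛ f y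
  -ᵛ-homo x y i = begin
    f (x -ᵛ y) i                    ≡⟨ addSub (f (x -ᵛ y) i) (f y i) ⟩
    f (x -ᵛ y) i + f y i - f y i    ≡⟨ cong (_- f y i) (+-homo (x -ᵛ y) y i) ⟨
    f ((x -ᵛ y) +ᵛ y) i - f y i     ≡⟨ cong (_- f y i) (cong-≗ (λ j → subAdd (x j) (y j)) i) ⟩
    f x i - f y i                   ∎
    where
    addSub : ∀ p q → p ≡ p + q - q
    addSub = solve-∀
    subAdd : ∀ p q → p - q + q ≡ p
    subAdd = solve-∀

open IsAdditive

-- Kronecker delta; stated with does rather than ⌊_⌋ so that δ (suc i) (suc j) reduces to δ i j.
δ : ∀ {n} → Fin n → Fin n → ℤ → ℤ
δ i j u = if does (i ≟ j) then u else + 0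

δ-sym : ∀ {n} (i j : Fin n) u → δ i j u ≡ δ j i u
δ-sym i j u with i ≟ j | j ≟ i
... | yes _   | yes _   = refl
... | no _    | no _    = refl
... | yes i≡j | no j≢i  = ⊥-elim (j≢i (sym i≡j))
... | no i≢j  | yes j≡i = ⊥-elim (i≢j (sym j≡i))

δ-zero : ∀ {n} (i j : Fin n) → δ i j (+ 0) ≡ + 0
δ-zero i j with i ≟ j
... | yes _ = refl
... | no _  = refl

δ-*ʳ : ∀ {n} (i j : Fin n) u v → δ i j u * v ≡ δ i j (u * v)
δ-*ʳ i j u v with i ≟ j
... | yes _ = refl
... | no _  = ℤP.*-zeroˡ v

Σℤ-δ : ∀ {n} (p : Fin n) (h : Fin n → ℤ) → Σℤ (λ k → δ k p (h k)) ≡ h p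
Σℤ-δ {suc n} zero    h = trans (cong (_+_ (h zero)) (Σℤ-zero {n})) (ℤP.+-identityʳ _)
Σℤ-δ {suc n} (suc p) h = trans (ℤP.+-identityˡ (Σℤ (λ k → δ k p (h (suc k))))) (Σℤ-δ p (h ∘ suc))

Σℤ-δʳ : ∀ {n} (p : Fin n) (h : Fin n → ℤ) → Σℤ (λ k → δ p k (h k)) ≡ h p
Σℤ-δʳ p h = trans (Σℤ-cong (λ k → δ-sym p k (h k))) (Σℤ-δ p h)

next-inject₁ : ∀ {m} (j : Fin m) → next (inject₁ j) ≡ suc j
next-inject₁ {m} j = FinP.toℕ-injective (begin
  toℕ (next (inject₁ j))        ≡⟨ FinP.toℕ-fromℕ< _ ⟩
  suc (toℕ (inject₁ j)) % suc m ≡⟨ m<n⇒m%n≡m (s≤s (FinP.inject₁ℕ< j)) ⟩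
  suc (toℕ (inject₁ j))         ≡⟨ cong suc (FinP.toℕ-inject₁ j) ⟩
  suc (toℕ j)                   ∎)

next-fromℕ : ∀ m → next (fromℕ m) ≡ zero
next-fromℕ m = FinP.toℕ-injective (begin
  toℕ (next (fromℕ m))        ≡⟨ FinP.toℕ-fromℕ< _ ⟩
  suc (toℕ (fromℕ m)) % suc m ≡⟨ cong (λ k → suc k % suc m) (FinP.toℕ-fromℕ m) ⟩
  suc m % suc m               ≡⟨ n%n≡0 (suc m) ⟩
  0                           ∎)

prev : ∀ {m} → Fin (suc m) → Fin (suc m)
prev zero    = fromℕ _
prev (suc i) = inject₁ i

next-prev : ∀ {m} (i : Fin (suc m)) → next (prev i) ≡ i
next-prev {m} zero = next-fromℕ m
next-prev (suc i)  = next-inject₁ i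

prev-next : ∀ {m} (i : Fin (suc m)) → prev (next i) ≡ i
prev-next i with view i
... | ‵fromℕ     = cong prev (next-fromℕ _)
... | ‵inject₁ j = cong prev (next-inject₁ j)

rotation : ∀ {m} → Permutation′ (suc m)
rotation = permutation next prev next-prev prev-next

δ-next : ∀ {m} (i j : Fin (suc m)) u → δ (next j) i u ≡ δ j (prev i) u
δ-next i j u with next j ≟ i | j ≟ prev i
... | yes _ | yes _ = refl
... | no _  | no _  = refl
... | yes nextj≡i | no j≢previ = ⊥-elim (j≢previ (trans (sym (prev-next j)) (cong prev nextj≡i)))
... | no nextj≢i  | yes j≡previ = ⊥-elim (nextj≢i (trans (cong next j≡previ) (next-prev i)))

laplacian-action : ∀ {n} (e : Fin n → Fin n → ℕ) (x : Fin n → ℤ) i →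
  Σℤ (λ j → laplacian e i j * x j) ≡ Σℤ (λ j → + e i j * (x i - x j))
laplacian-action e x i = begin
  Σℤ (λ j → laplacian e i j * x j)             ≡⟨ Σℤ-cong splitDiagonal ⟩
  Σℤ (λ j → δ i j (deg * x j) - w j * x j)     ≡⟨ Σℤ-- (λ j → δ i j (deg * x j)) (λ j → w j * x j) ⟩
  Σℤ (λ j → δ i j (deg * x j)) - Σwx           ≡⟨ cong (_- Σwx) (Σℤ-δʳ i (λ j → deg * x j)) ⟩
  deg * x i - Σwx                              ≡⟨ cong (λ d → d * x i - Σwx) (pos-Σℕ offDiagonal) ⟩
  Σℤ w * x i - Σwx                             ≡⟨ cong (_- Σwx) (Σℤ-*ʳ w (x i)) ⟩
  Σℤ (λ j → w j * x i) - Σwx                   ≡⟨ Σℤ-- (λ j → w j * x i) (λ j → w j * x j) ⟨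
  Σℤ (λ j → w j * x i - w j * x j)             ≡⟨ Σℤ-cong (λ j → trans (factor (w j) (x i) (x j)) (dropDiagonal j)) ⟩
  Σℤ (λ j → + e i j * (x i - x j))             ∎
  where
  offDiagonal : Fin _ → ℕ
  offDiagonal j = if ⌊ i ≟ j ⌋ then 0 else e i j
  w : Fin _ → ℤ
  w = +_ ∘ offDiagonal
  deg : ℤ
  deg = + degree e i
  Σwx : ℤ
  Σwx = Σℤ (λ j → w j * x j)
  splitDiagonal : ∀ j → laplacian e i j * x j ≡ δ i j (deg * x j) - w j * x j
  splitDiagonal j with i ≟ j
  ... | yes _ = sym (trans (cong (_+_ (deg * x j)) (cong -_ (ℤP.*-zeroˡ (x j)))) (ℤP.+-identityʳ _))
  ... | no _  = sym (trans (ℤP.+-identityˡ _) (ℤP.neg-distribˡ-* (+ e i j) (x j)))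
  factor : ∀ c p q → c * p - c * q ≡ c * (p - q)
  factor = solve-∀
  dropDiagonal : ∀ j → w j * (x i - x j) ≡ + e i j * (x i - x j)
  dropDiagonal j with i ≟ j
  ... | yes refl rewrite ℤP.+-inverseʳ (x i) = trans (ℤP.*-zeroʳ (+ 0)) (sym (ℤP.*-zeroʳ (+ e i i)))
  ... | no _ = refl

thickEdges-offDiagonal : ∀ {m} (a : Fin (suc m) → ℕ) {i j} → i ≢ j →
  + thickEdges a i j ≡ δ (next i) j (+ a i) + δ j (prev i) (+ a j)
thickEdges-offDiagonal a {i} {j} i≢j = begin
  + thickEdges a i j
    ≡⟨ pos-Σℕ incidence ⟩
  Σℤ (+_ ∘ incidence)
    ≡⟨ Σℤ-cong edgeCount ⟩
  Σℤ (λ k → δ k i (δ (next k) j (+ a k)) + δ k j (δ (next k) i (+ a k)))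
    ≡⟨ Σℤ-+ (λ k → δ k i (δ (next k) j (+ a k))) (λ k → δ k j (δ (next k) i (+ a k))) ⟩
  Σℤ (λ k → δ k i (δ (next k) j (+ a k))) + Σℤ (λ k → δ k j (δ (next k) i (+ a k)))
    ≡⟨ cong₂ _+_ (Σℤ-δ i (λ k → δ (next k) j (+ a k))) (Σℤ-δ j (λ k → δ (next k) i (+ a k))) ⟩
  δ (next i) j (+ a i) + δ (next j) i (+ a j)
    ≡⟨ cong (_+_ (δ (next i) j (+ a i))) (δ-next i j (+ a j)) ⟩
  δ (next i) j (+ a i) + δ j (prev i) (+ a j)
    ∎
  where
  incidence : Fin _ → ℕ
  incidence k = if ⌊ ((k ≟ i) ×-dec (next k ≟ j)) ⊎-dec ((k ≟ j) ×-dec (next k ≟ i)) ⌋ then a k else 0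
  edgeCount : ∀ k → + incidence k ≡ δ k i (δ (next k) j (+ a k)) + δ k j (δ (next k) i (+ a k))
  edgeCount k with k ≟ i | next k ≟ j | k ≟ j | next k ≟ i
  ... | yes k≡i | _     | yes k≡j | _     = ⊥-elim (i≢j (trans (sym k≡i) k≡j))
  ... | yes _   | yes _ | no _    | _     = sym (ℤP.+-identityʳ _)
  ... | yes _   | no _  | no _    | _     = refl
  ... | no _    | _     | yes _   | yes _ = sym (ℤP.+-identityˡ _)
  ... | no _    | _     | yes _   | no _  = refl
  ... | no _    | _     | no _    | _     = refl

drop : ∀ {m} → (Fin (suc m) → ℤ) → Fin (suc m) → ℤ
drop x k = x k - x (next k)

current : ∀ {m} → (Fin (suc m) → ℕ) → (Fin (suc m) → ℤ) → Fin (suc m) → ℤ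
current a x k = + a k * drop x k

thickCycle-kirchhoff : ∀ {m} (a : Fin (suc m) → ℕ) (x : Fin (suc m) → ℤ) i →
  Σℤ (λ j → + thickEdges a i j * (x i - x j)) ≡ current a x i - current a x (prev i)
thickCycle-kirchhoff a x i = begin
  Σℤ (λ j → + thickEdges a i j * (x i - x j))
    ≡⟨ Σℤ-cong neighbours ⟩
  Σℤ (λ j → δ (next i) j (+ a i * (x i - x j)) + δ j (prev i) (+ a j * (x i - x j)))
    ≡⟨ Σℤ-+ (λ j → δ (next i) j (+ a i * (x i - x j))) (λ j → δ j (prev i) (+ a j * (x i - x j))) ⟩
  Σℤ (λ j → δ (next i) j (+ a i * (x i - x j))) + Σℤ (λ j → δ j (prev i) (+ a j * (x i - x j)))
    ≡⟨ cong₂ _+_ (Σℤ-δʳ (next i) (λ j → + a i * (x i - x j))) (Σℤ-δ (prev i) (λ j → + a j * (x i - x j))) ⟩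
  + a i * (x i - x (next i)) + + a (prev i) * (x i - x (prev i))
    ≡⟨ cong (λ k → + a i * (x i - x (next i)) + + a (prev i) * (x k - x (prev i))) (next-prev i) ⟨
  + a i * (x i - x (next i)) + + a (prev i) * (x (next (prev i)) - x (prev i))
    ≡⟨ reverse (+ a i * (x i - x (next i))) (+ a (prev i)) (x (next (prev i))) (x (prev i)) ⟩
  current a x i - current a x (prev i)
    ∎
  where
  reverse : ∀ u c p q → u + c * (p - q) ≡ u - c * (q - p)
  reverse = solve-∀
  neighbours : ∀ j → + thickEdges a i j * (x i - x j)
    ≡ δ (next i) j (+ a i * (x i - x j)) + δ j (prev i) (+ a j * (x i - x j))
  neighbours j with i ≟ j
  ... | yes refl
    rewrite ℤP.+-inverseʳ (x i) | ℤP.*-zeroʳ (+ thickEdges a i i) | ℤP.*-zeroʳ (+ a i)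
          | δ-zero (next i) i | δ-zero i (prev i) = refl
  ... | no i≢j = begin
    + thickEdges a i j * (x i - x j)
      ≡⟨ cong (_* (x i - x j)) (thickEdges-offDiagonal a i≢j) ⟩
    (δ (next i) j (+ a i) + δ j (prev i) (+ a j)) * (x i - x j)
      ≡⟨ ℤP.*-distribʳ-+ (x i - x j) (δ (next i) j (+ a i)) _ ⟩
    δ (next i) j (+ a i) * (x i - x j) + δ j (prev i) (+ a j) * (x i - x j)
      ≡⟨ cong₂ _+_ (δ-*ʳ (next i) j _ _) (δ-*ʳ j (prev i) _ _) ⟩
    δ (next i) j (+ a i * (x i - x j)) + δ j (prev i) (+ a j * (x i - x j))
      ∎

-- Divergence of an edge flow g (edge k runs from k to k + 1) at all vertices but the last.
∂ : ∀ {m} → (Fin (suc m) → ℤ) → Vecℤ m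
∂ g i = g (inject₁ i) - g (prev (inject₁ i))

∂-cong : ∀ {m} {g h : Fin (suc m) → ℤ} → g ≗ h → ∂ g ≗ ∂ h
∂-cong g≗h i = cong₂ _-_ (g≗h _) (g≗h _)

∂-+ : ∀ {m} (g h : Fin (suc m) → ℤ) i → ∂ (λ k → g k + h k) i ≡ ∂ g i + ∂ h i
∂-+ g h i = exchange (g (inject₁ i)) (h (inject₁ i)) (g (prev (inject₁ i))) (h (prev (inject₁ i)))
  where
  exchange : ∀ p q r s → (p + q) - (r + s) ≡ (p - r) + (q - s)
  exchange = solve-∀

∂-- : ∀ {m} (g h : Fin (suc m) → ℤ) i → ∂ (λ k → g k - h k) i ≡ ∂ g i - ∂ h i
∂-- g h i = exchange (g (inject₁ i)) (h (inject₁ i)) (g (prev (inject₁ i))) (h (prev (inject₁ i)))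
  where
  exchange : ∀ p q r s → (p - q) - (r - s) ≡ (p - r) - (q - s)
  exchange = solve-∀

∂-shift : ∀ {m} (g : Fin (suc m) → ℤ) c i → ∂ (λ k → g k + c) i ≡ ∂ g i
∂-shift g c i = cancel (g (inject₁ i)) (g (prev (inject₁ i))) c
  where
  cancel : ∀ p q c → (p + c) - (q + c) ≡ p - q
  cancel = solve-∀

consecutive-constant : ∀ {A : Set} {m} (f : Fin (suc m) → A) →
  (∀ j → f (suc j) ≡ f (inject₁ j)) → ∀ k → f k ≡ f zero
consecutive-constant f step zero = refl
consecutive-constant {m = suc m} f step (suc k) =
  trans (consecutive-constant (f ∘ suc) (step ∘ suc) k) (step zero)

∂-kernel : ∀ {m} (d : Fin (suc m) → ℤ) → (∀ i → ∂ d i ≡ + 0) → ∀ k → d k ≡ d (fromℕ m)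
∂-kernel {zero}  d _     zero = refl
∂-kernel {suc m} d ∂d≡0 k with view k
... | ‵fromℕ     = refl
... | ‵inject₁ j = trans (consecutive-constant (d ∘ inject₁) (flat ∘ suc) j) (flat zero)
  where
  flat : ∀ i → d (inject₁ i) ≡ d (prev (inject₁ i))
  flat i = ℤP.i-j≡0⇒i≡j _ _ (∂d≡0 i)

ground : ∀ {m} → Vecℤ m → Fin (suc m) → ℤ
ground {zero}  z zero    = + 0
ground {suc m} z zero    = z zero
ground {suc m} z (suc k) = ground (z ∘ suc) k

ground-inject₁ : ∀ {m} (z : Vecℤ m) j → ground z (inject₁ j) ≡ z j
ground-inject₁ {suc m} z zero    = refl
ground-inject₁ {suc m} z (suc j) = ground-inject₁ (z ∘ suc) j

ground-fromℕ : ∀ {m} (z : Vecℤ m) → ground z (fromℕ m) ≡ + 0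
ground-fromℕ {zero}  z = refl
ground-fromℕ {suc m} z = ground-fromℕ (z ∘ suc)

ground-cong : ∀ {m} {y z : Vecℤ m} → y ≗ z → ground y ≗ ground z
ground-cong {zero}  y≗z zero    = refl
ground-cong {suc m} y≗z zero    = y≗z zero
ground-cong {suc m} y≗z (suc k) = ground-cong (y≗z ∘ suc) k

partialSums : ∀ {m} → Vecℤ m → Vecℤ m
partialSums y zero    = y zero
partialSums y (suc j) = y zero + partialSums (y ∘ suc) j

partialSums-suc : ∀ {m} (y : Vecℤ (suc m)) j →
  partialSums y (suc j) ≡ partialSums y (inject₁ j) + y (suc j)
partialSums-suc y zero    = refl
partialSums-suc y (suc j) =
  trans (cong (_+_ (y zero)) (partialSums-suc (y ∘ suc) j)) (sym (ℤP.+-assoc (y zero) _ _))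

partialSums-cong : ∀ {m} {y z : Vecℤ m} → y ≗ z → partialSums y ≗ partialSums z
partialSums-cong y≗z zero    = y≗z zero
partialSums-cong y≗z (suc j) = cong₂ _+_ (y≗z zero) (partialSums-cong (y≗z ∘ suc) j)

∫ : ∀ {m} → Vecℤ m → Fin (suc m) → ℤ
∫ y = ground (partialSums y)

∫-cong : ∀ {m} {y z : Vecℤ m} → y ≗ z → ∫ y ≗ ∫ z
∫-cong = ground-cong ∘ partialSums-cong

∂-∫ : ∀ {m} (y : Vecℤ m) → ∂ (∫ y) ≗ y
∂-∫ y zero    = trans (cong (_-_ (y zero)) (ground-fromℕ (partialSums y))) (ℤP.+-identityʳ (y zero))
∂-∫ y (suc j) = begin
  ground (partialSums y ∘ suc) (inject₁ j) - ground (partialSums y) (inject₁ (inject₁ j))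
    ≡⟨ cong₂ _-_ (ground-inject₁ _ j) (ground-inject₁ _ (inject₁ j)) ⟩
  partialSums y (suc j) - partialSums y (inject₁ j)
    ≡⟨ cong (_- partialSums y (inject₁ j)) (partialSums-suc y j) ⟩
  partialSums y (inject₁ j) + y (suc j) - partialSums y (inject₁ j)
    ≡⟨ cancel (partialSums y (inject₁ j)) (y (suc j)) ⟩
  y (suc j) ∎
  where
  cancel : ∀ p q → p + q - p ≡ q
  cancel = solve-∀

Σℤ-drop : ∀ {m} (x : Fin (suc m) → ℤ) → Σℤ (drop x) ≡ + 0
Σℤ-drop x = begin
  Σℤ (drop x)          ≡⟨ Σℤ-- x (x ∘ next) ⟩
  Σℤ x - Σℤ (x ∘ next) ≡⟨ cong (_-_ (Σℤ x)) (Σℤ-permute rotation x) ⟩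
  Σℤ x - Σℤ x          ≡⟨ ℤP.+-inverseʳ (Σℤ x) ⟩
  + 0                  ∎

-- z is ∫ of −t on the edges entering 0, …, m − 1; then t and drop (ground z) agree away
-- from the edge entering the last vertex, and on it because both have zero sum.
drop-surjective : ∀ {m} (t : Fin (suc m) → ℤ) → Σℤ t ≡ + 0 →
  ∃ λ z → ∀ k → t k ≡ drop (ground z) k
drop-surjective {m} t Σt≡0 = partialSums y , everywhere
  where
  y : Vecℤ m
  y j = - t (prev (inject₁ j))
  x : Fin (suc m) → ℤ
  x = ∫ y
  swap : ∀ p q → - (p - q) ≡ q - p
  swap = solve-∀
  intoInject₁ : ∀ j → t (prev (inject₁ j)) ≡ drop x (prev (inject₁ j))
  intoInject₁ j = begin
    t (prev î)               ≡⟨ ℤP.neg-involutive _ ⟨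
    - y j                    ≡⟨ cong -_ (∂-∫ y j) ⟨
    - (x î - x (prev î))     ≡⟨ swap (x î) (x (prev î)) ⟩
    x (prev î) - x î         ≡⟨ cong (λ k → x (prev î) - x k) (next-prev î) ⟨
    drop x (prev î)          ∎
    where
    î = inject₁ j
  notIntoLast : ∀ i → i ≢ fromℕ m → t (prev i) ≡ drop x (prev i)
  notIntoLast i i≢last with view i
  ... | ‵fromℕ     = ⊥-elim (i≢last refl)
  ... | ‵inject₁ j = intoInject₁ j
  elsewhere : ∀ k → k ≢ prev (fromℕ m) → t k ≡ drop x k
  elsewhere k k≢p = subst (λ k′ → t k′ ≡ drop x k′) (prev-next k)
    (notIntoLast (next k) (λ next≡last → k≢p (trans (sym (prev-next k)) (cong prev next≡last))))
  everywhere : ∀ k → t k ≡ drop x k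
  everywhere k with k ≟ prev (fromℕ m)
  ... | yes refl = Σℤ-agree k (trans Σt≡0 (sym (Σℤ-drop x))) elsewhere
  ... | no k≢p   = elsewhere k k≢p

reduced-laplacian-action : ∀ {m} (a : Fin (suc m) → ℕ) (z : Vecℤ m) →
  sandpileMatrix a · z ≗ ∂ (current a (ground z))
reduced-laplacian-action {m} a z i = begin
  Σℤ (λ j → L î (inject₁ j) * z j)
    ≡⟨ Σℤ-cong (λ j → cong (L î (inject₁ j) *_) (ground-inject₁ z j)) ⟨
  S
    ≡⟨ ℤP.+-identityʳ S ⟨
  S + + 0
    ≡⟨ cong (_+_ S) (trans (cong (L î (fromℕ m) *_) (ground-fromℕ z)) (ℤP.*-zeroʳ (L î (fromℕ m)))) ⟨
  S + L î (fromℕ m) * x (fromℕ m)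
    ≡⟨ Σℤ-init-last (λ j → L î j * x j) ⟨
  Σℤ (λ j → L î j * x j)
    ≡⟨ laplacian-action (thickEdges a) x î ⟩
  Σℤ (λ j → + thickEdges a î j * (x î - x j))
    ≡⟨ thickCycle-kirchhoff a x î ⟩
  current a x î - current a x (prev î)
    ∎
  where
  L = laplacian (thickEdges a)
  x = ground z
  î = inject₁ i
  S = Σℤ (λ j → L î (inject₁ j) * x (inject₁ j))

-- The relabelling ρ of ℤ^n, transported along ∂ : ℤ^n / constants ≅ ℤ^{n−1}.
relabel : ∀ {m} → (Fin (suc m) → Fin (suc m)) → Vecℤ m → Vecℤ m
relabel ρ y = ∂ (∫ y ∘ ρ)

relabel-cong : ∀ {m} ρ {y z : Vecℤ m} → y ≗ z → relabel ρ y ≗ relabel ρ z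
relabel-cong ρ y≗z = ∂-cong (∫-cong y≗z ∘ ρ)

relabel-∂ : ∀ {m} (ρ : Fin (suc m) → Fin (suc m)) (g : Fin (suc m) → ℤ) →
  relabel ρ (∂ g) ≗ ∂ (g ∘ ρ)
relabel-∂ {m} ρ g i = begin
  ∂ (∫ (∂ g) ∘ ρ) i          ≡⟨ ∂-cong (shifted ∘ ρ) i ⟩
  ∂ (λ k → g (ρ k) + c) i    ≡⟨ ∂-shift (g ∘ ρ) c i ⟩
  ∂ (g ∘ ρ) i                ∎
  where
  d : Fin (suc m) → ℤ
  d k = ∫ (∂ g) k - g k
  c : ℤ
  c = d (fromℕ m)
  d-flat : ∀ k → d k ≡ c
  d-flat = ∂-kernel d (λ j → trans (∂-- (∫ (∂ g)) g j) (ℤP.i≡j⇒i-j≡0 (∂-∫ (∂ g) j)))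
  split : ∀ p q → p ≡ q + (p - q)
  split = solve-∀
  shifted : ∀ k → ∫ (∂ g) k ≡ g k + c
  shifted k = trans (split (∫ (∂ g) k) (g k)) (cong (_+_ (g k)) (d-flat k))

relabel-+ : ∀ {m} ρ (y z : Vecℤ m) → relabel ρ (y +ᵛ z) ≗ relabel ρ y +ᵛ relabel ρ z
relabel-+ ρ y z i = begin
  relabel ρ (y +ᵛ z) i                  ≡⟨ relabel-cong ρ y+z≗∂ i ⟩
  relabel ρ (∂ (λ k → ∫ y k + ∫ z k)) i ≡⟨ relabel-∂ ρ (λ k → ∫ y k + ∫ z k) i ⟩
  ∂ (λ k → ∫ y (ρ k) + ∫ z (ρ k)) i     ≡⟨ ∂-+ (∫ y ∘ ρ) (∫ z ∘ ρ) i ⟩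
  relabel ρ y i + relabel ρ z i         ∎
  where
  y+z≗∂ : y +ᵛ z ≗ ∂ (λ k → ∫ y k + ∫ z k)
  y+z≗∂ j = sym (trans (∂-+ (∫ y) (∫ z) j) (cong₂ _+_ (∂-∫ y j) (∂-∫ z j)))

relabel-inverse : ∀ {m} (ρ τ : Fin (suc m) → Fin (suc m)) → (∀ k → τ (ρ k) ≡ k) →
  ∀ y → relabel ρ (relabel τ y) ≗ y
relabel-inverse ρ τ τρ≡id y i = begin
  relabel ρ (∂ (∫ y ∘ τ)) i ≡⟨ relabel-∂ ρ (∫ y ∘ τ) i ⟩
  ∂ (∫ y ∘ τ ∘ ρ) i         ≡⟨ ∂-cong (cong (∫ y) ∘ τρ≡id) i ⟩
  ∂ (∫ y) i                 ≡⟨ ∂-∫ y i ⟩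
  y i                       ∎

relabel-image : ∀ {m} {a b : Fin (suc m) → ℕ} (σ : Permutation′ (suc m)) →
  (∀ k → b k ≡ a (σ ⟨$⟩ʳ k)) →
  ∀ z → ∃ λ w → relabel (σ ⟨$⟩ʳ_) (sandpileMatrix a · z) ≗ sandpileMatrix b · w
relabel-image {a = a} {b} σ b≡aσ z
  with drop-surjective (drop (ground z) ∘ (σ ⟨$⟩ʳ_))
                       (trans (Σℤ-permute σ (drop (ground z))) (Σℤ-drop (ground z)))
... | w , dropσ≡drop = w , λ i → begin
  relabel ρ (sandpileMatrix a · z) i   ≡⟨ relabel-cong ρ (reduced-laplacian-action a z) i ⟩
  relabel ρ (∂ (current a x)) i        ≡⟨ relabel-∂ ρ (current a x) i ⟩
  ∂ (current a x ∘ ρ) i                ≡⟨ ∂-cong currents i ⟩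
  ∂ (current b (ground w)) i           ≡⟨ reduced-laplacian-action b w i ⟨
  (sandpileMatrix b · w) i             ∎
  where
  ρ = σ ⟨$⟩ʳ_
  x = ground z
  currents : ∀ k → current a x (ρ k) ≡ current b (ground w) k
  currents k = cong₂ (λ c v → + c * v) (sym (b≡aσ k)) (dropσ≡drop k)

relabel-isAdditive : ∀ {m} (ρ : Fin (suc m) → Fin (suc m)) → IsAdditive (relabel ρ)
relabel-isAdditive ρ = record { cong-≗ = relabel-cong ρ ; +-homo = relabel-+ ρ }

·-zero : ∀ {m} (M : Matrix m m) → M · (λ _ → + 0) ≗ (λ _ → + 0)
·-zero {m} M i = trans (Σℤ-cong (λ j → ℤP.*-zeroʳ (M i j))) (Σℤ-zero {m})

≗⇒≈ : ∀ {m} (M : Matrix m m) {x y : Vecℤ m} → x ≗ y → x ≈[ M ] y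
≗⇒≈ M x≗y = (λ _ → + 0) , λ i → trans (ℤP.i≡j⇒i-j≡0 (x≗y i)) (sym (·-zero M i))

additive-respects-≈ : ∀ {m k} {M : Matrix m m} {N : Matrix k k} {f : Vecℤ m → Vecℤ k} →
  IsAdditive f → (∀ z → ∃ λ w → f (M · z) ≗ N · w) → ∀ x y → x ≈[ M ] y → f x ≈[ N ] f y
additive-respects-≈ {M = M} {N} {f} f-additive image x y (z , x-y≡Mz) with image z
... | w , fMz≡Nw = w , λ i → begin
  f x i - f y i   ≡⟨ -ᵛ-homo f-additive x y i ⟨
  f (x -ᵛ y) i    ≡⟨ cong-≗ f-additive x-y≡Mz i ⟩
  f (M · z) i     ≡⟨ fMz≡Nw i ⟩
  (N · w) i       ∎

cokerIso : ∀ {m k} {M : Matrix m m} {N : Matrix k k}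
  (f : Vecℤ m → Vecℤ k) (g : Vecℤ k → Vecℤ m) → IsAdditive f → IsAdditive g →
  (∀ z → ∃ λ w → f (M · z) ≗ N · w) → (∀ w → ∃ λ z → g (N · w) ≗ M · z) →
  (∀ y → f (g y) ≗ y) → (∀ x → g (f x) ≗ x) → CokerIso M N
cokerIso {M = M} {N} f g f-additive g-additive f-image g-image fg≗id gf≗id = record
  { to        = f
  ; from      = g
  ; to-cong   = additive-respects-≈ {M = M} {N} f-additive f-image
  ; from-cong = additive-respects-≈ {M = N} {M} g-additive g-image
  ; to-hom    = λ x y → ≗⇒≈ N (+-homo f-additive x y)
  ; from-hom  = λ x y → ≗⇒≈ M (+-homo g-additive x y)
  ; to-from   = λ y → ≗⇒≈ N (fg≗id y)
  ; from-to   = λ x → ≗⇒≈ M (gf≗id x)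
  }

thickCycle-sandpile-permute : ∀ {m} (a : Fin (suc m) → ℕ) (σ : Permutation′ (suc m)) →
  SandpileIso a (λ i → a (σ ⟨$⟩ʳ i))
thickCycle-sandpile-permute a σ =
  cokerIso (relabel (σ ⟨$⟩ʳ_)) (relabel (σ ⟨$⟩ˡ_))
    (relabel-isAdditive (σ ⟨$⟩ʳ_)) (relabel-isAdditive (σ ⟨$⟩ˡ_))
    (relabel-image {a = a} σ (λ _ → refl))
    (relabel-image {a = λ i → a (σ ⟨$⟩ʳ i)} {b = a} (flip σ) (λ _ → cong a (sym (inverseʳ σ))))
    (relabel-inverse (σ ⟨$⟩ʳ_) (σ ⟨$⟩ˡ_) (λ _ → inverseˡ σ))
    (relabel-inverse (σ ⟨$⟩ˡ_) (σ ⟨$⟩ʳ_) (λ _ → inverseʳ σ))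

corollary1 : (n : ℕ) → 3 ≤ n → (a : Fin n → ℕ) → (∀ i → 0 < a i) →
    (σ : Permutation′ n) → SandpileIso a (λ i → a (σ ⟨$⟩ʳ i))
corollary1 zero    ()
corollary1 (suc m) _ a _ σ = thickCycle-sandpile-permute a σ
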